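{- Let $v\ge k\ge 3$ and $c\ge 2$ be integers. Write $k=qc+b$ and $v=\rho c+\beta$ with integers $q,\rho$ and $0\le b<c$, $0\le\beta<c$. If there exists a block-equitably $c$-coloured packing {\rm PD}$(v,k,1)$ with $m$ blocks, then \[ m\le \frac{\rho\left(\frac{\rho c}{2}+\beta\right)(c-1)+\frac{\beta}{2}(\beta-1)}{q\left(\frac{qc}{2}+b\right)(c-1)+\frac{b}{2}(b-1)}. \]
   Context: A packing design {\rm PD}$(v,k,1)$ is a pair $(V,{\cal B})$ where $|V|=v$ and ${\cal B}$ is a collection of $k$-subsets (blocks) of $V$ such that every pair of points occurs in at most one block; its size is the number of blocks. A $c$-colouring is a function $f:V\to{\cal C}$ with $|{\cal C}|=c$, with colour classes $F(\gamma)=f^{ -1}(\gamma)$; it is block-equitable if $\lfloor k/c\rfloor\le |B\cap F(\gamma)|\le\lceil k/c\rceil$ for every colour $\gamma$ and every block $B$. -}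

module Defs where

open import Data.Nat using (ℕ; zero; suc; _+_; _∸_; _≤_)
open import Data.Nat.DivMod using (_/_)
open import Data.Fin using (Fin; _≟_)
open import Data.Fin.Subset using (Subset; _∈_; _∩_; ∣_∣)
open import Data.Vec using (tabulate)
open import Data.Product using (_×_)
open import Relation.Nullary using (¬_)
open import Relation.Nullary.Decidable using (⌊_⌋)
open import Relation.Binary.PropositionalEquality using (_≡_)

-- floor and ceiling of k / c (for c = 0 we return 0; only used with c ≥ 2)
floorDiv : ℕ → ℕ → ℕ
floorDiv k zero = zero
floorDiv k (suc c) = k / suc c

ceilDiv : ℕ → ℕ → ℕ
ceilDiv k c = floorDiv (k + c ∸ 1) c

IsPacking : (v k m : ℕ) → (Fin m → Subset v) → Set
IsPacking v k m B =
  ((i : Fin m) → ∣ B i ∣ ≡ k) ×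
  ((x y : Fin v) → ¬ (x ≡ y) → (i j : Fin m) →
     x ∈ B i → y ∈ B i → x ∈ B j → y ∈ B j → i ≡ j)

colourClass : {v c : ℕ} → (Fin v → Fin c) → Fin c → Subset v
colourClass f γ = tabulate (λ x → ⌊ f x ≟ γ ⌋)

IsBlockEquitable : (v k m c : ℕ) → (Fin m → Subset v) → (Fin v → Fin c) → Set
IsBlockEquitable v k m c B f =
  (i : Fin m) → (γ : Fin c) →
    (floorDiv k c ≤ ∣ B i ∩ colourClass f γ ∣) × (∣ B i ∩ colourClass f γ ∣ ≤ ceilDiv k c)

-- Count ordered pairs of points of different colours. In a block of k = q c + b points whose colour
-- classes have q or q + 1 points each, n² + q (q + 1) = (2q + 1) n for every class size n, so the
-- sum of squares of the class sizes, and hence the number k² − Σ n² of such pairs, is determined.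
-- For the classes of all v = ρ c + β points one only has n² + ρ (ρ + 1) ≥ (2ρ + 1) n, which bounds
-- the number of such pairs from above. A pair of points lies in at most one block, so m times the
-- first count is at most the second.
module Submission where

open import Defs
open import Data.Nat using (ℕ; _+_; _*_; _∸_; _≤_; _<_)
open import Data.Fin using (Fin)
open import Data.Fin.Subset using (Subset)
open import Data.Product using (Σ; _×_)
open import Relation.Binary.PropositionalEquality using (_≡_)

open import Data.Bool using (Bool; true; false; _∧_; not)
open import Data.Nat using (zero; suc; z≤n; s≤s; z<s)
open import Data.Nat.Properties
  using (+-*-semiring; +-identityʳ; *-identityʳ; *-zeroʳ; +-suc; +-comm; *-comm;
         +-mono-≤; +-monoʳ-≤; *-mono-≤; +-mono-<; +-monoʳ-<; +-cancelʳ-≡; +-cancelʳ-≤;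
         ≤-refl; ≤-reflexive; ≤-trans; <-≤-trans; ≤-antisym; ≤-pred; n<1+n; m≤m+n; _≤?_; ≰⇒>;
         ≮⇒≥; n≤0⇒n≡0; m≤n⇒∃[o]m+o≡n; m≤n⇒m<n∨m≡n; module ≤-Reasoning)
open import Data.Nat.DivMod using (_/_; m*n/n≡m; /-monoˡ-≤; m<n*o⇒m/o<n)
open import Data.Nat.Tactic.RingSolver using (solve-∀)
open import Data.Fin using (zero; suc; _≟_)
open import Data.Fin.Properties using (0≢1+n; suc-injective)
open import Data.Fin.Subset using (_∈_; _∩_; ∣_∣)
open import Data.Vec using ([]; _∷_; lookup)
open import Data.Vec.Properties using (lookup-zipWith; lookup∘tabulate; lookup⇒[]=)
open import Data.Product using (_,_; proj₁; proj₂)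
open import Data.Sum using (inj₁; inj₂)
open import Function using (_∘_)
open import Relation.Nullary.Decidable using (⌊_⌋; yes; no)
open import Relation.Binary.PropositionalEquality using (refl; sym; trans; cong; cong₂; subst; module ≡-Reasoning)
open import Algebra.Properties.Semiring.Sum +-*-semiring
  using (sum; sum-syntax; ∑-comm; ∑-distrib-+; *-distribˡ-sum; *-distribʳ-sum; sum-cong-≗; sum-replicate-zero)

indicator : Bool → ℕ
indicator true  = 1
indicator false = 0

indicator≤1 : ∀ b → indicator b ≤ 1
indicator≤1 true  = s≤s z≤n
indicator≤1 false = z≤n

indicator-∧ : ∀ a b → indicator (a ∧ b) ≡ indicator a * indicator b
indicator-∧ true  true  = refl
indicator-∧ true  false = refl
indicator-∧ false _     = refl

split-by-indicator : ∀ t b → t ≡ t * indicator b + t * indicator (not b)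
split-by-indicator t true  = sym (trans (cong₂ _+_ (*-identityʳ t) (*-zeroʳ t)) (+-identityʳ t))
split-by-indicator t false = sym (cong₂ _+_ (*-zeroʳ t) (*-identityʳ t))

⌊suc≟suc⌋ : ∀ {n} (a b : Fin n) → ⌊ Fin.suc a ≟ suc b ⌋ ≡ ⌊ a ≟ b ⌋
⌊suc≟suc⌋ a b with a ≟ b
... | yes _ = refl
... | no  _ = refl

sum-mono-≤ : ∀ {n} {f g : Fin n → ℕ} → (∀ i → f i ≤ g i) → sum f ≤ sum g
sum-mono-≤ {zero}  _   = z≤n
sum-mono-≤ {suc n} f≤g = +-mono-≤ (f≤g zero) (sum-mono-≤ (f≤g ∘ suc))

sum-const : ∀ n a → ∑[ i < n ] a ≡ n * a
sum-const zero    a = refl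
sum-const (suc n) a = cong (a +_) (sum-const n a)

sum-zero : ∀ {n} {f : Fin n → ℕ} → (∀ i → f i ≡ 0) → sum f ≡ 0
sum-zero {n} f≡0 = trans (sum-cong-≗ f≡0) (sum-replicate-zero n)

sum-plus-const : ∀ {n} (f : Fin n → ℕ) t → ∑[ i < n ] (f i + t) ≡ sum f + n * t
sum-plus-const {n} f t = trans (∑-distrib-+ f (λ _ → t)) (cong (sum f +_) (sum-const n t))

sum*sum : ∀ {m n} (f : Fin m → ℕ) (g : Fin n → ℕ) → sum f * sum g ≡ ∑[ x < m ] ∑[ y < n ] (f x * g y)
sum*sum f g = trans (*-distribʳ-sum (sum g) f) (sum-cong-≗ (λ x → *-distribˡ-sum (f x) g))

sum-δ : ∀ {n} (a : Fin n) (g : Fin n → ℕ) → ∑[ γ < n ] (indicator ⌊ a ≟ γ ⌋ * g γ) ≡ g a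
sum-δ {suc n} zero g = begin
  g zero + 0 + ∑[ γ < n ] 0 ≡⟨ cong (g zero + 0 +_) (sum-replicate-zero n) ⟩
  g zero + 0 + 0            ≡⟨ trans (+-identityʳ _) (+-identityʳ _) ⟩
  g zero                    ∎
  where open ≡-Reasoning
sum-δ {suc n} (suc a) g = trans
  (sum-cong-≗ (λ γ → cong (λ b → indicator b * g (suc γ)) (⌊suc≟suc⌋ a γ)))
  (sum-δ a (g ∘ suc))

sum-≤1 : ∀ {n} (g : Fin n → ℕ) → (∀ i → g i ≤ 1) →
  (∀ i j → 0 < g i → 0 < g j → i ≡ j) → sum g ≤ 1
sum-≤1 {zero}  _ _ _ = z≤n
sum-≤1 {suc n} g g≤1 unique with g zero in g₀≡
... | zero  = sum-≤1 (g ∘ suc) (g≤1 ∘ suc)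
                (λ i j gᵢ>0 gⱼ>0 → suc-injective (unique (suc i) (suc j) gᵢ>0 gⱼ>0))
... | suc k = subst (_≤ 1) g₀≡+rest (g≤1 zero)
  where
  rest≡0 : ∀ i → g (suc i) ≡ 0
  rest≡0 i = n≤0⇒n≡0 (≮⇒≥ (λ gᵢ>0 →
    0≢1+n (unique zero (suc i) (subst (0 <_) (sym g₀≡) z<s) gᵢ>0)))
  g₀≡+rest : g zero ≡ suc k + sum (g ∘ suc)
  g₀≡+rest = trans g₀≡ (sym (trans (cong (suc k +_) (sum-zero rest≡0)) (+-identityʳ _)))

χ : ∀ {n} → Subset n → Fin n → ℕ
χ p x = indicator (lookup p x)

∣p∣≡∑χ : ∀ {n} (p : Subset n) → ∣ p ∣ ≡ sum (χ p)
∣p∣≡∑χ []          = refl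
∣p∣≡∑χ (true ∷ p)  = cong suc (∣p∣≡∑χ p)
∣p∣≡∑χ (false ∷ p) = ∣p∣≡∑χ p

χ-∩ : ∀ {n} (p q : Subset n) x → χ (p ∩ q) x ≡ χ p x * χ q x
χ-∩ p q x = trans (cong indicator (lookup-zipWith _∧_ x p q)) (indicator-∧ (lookup p x) (lookup q x))

-- The factor 1 is the colour term indicator (not false) of a bichromatic pair in bichromaticPairs.
∈-from-χ*χ : ∀ {n} (p : Subset n) x y → 0 < χ p x * χ p y * 1 → x ∈ p × y ∈ p
∈-from-χ*χ p x y pos with lookup p x in px | lookup p y in py
∈-from-χ*χ p x y pos  | true  | true  = lookup⇒[]= x p px , lookup⇒[]= y p py
∈-from-χ*χ p x y ()   | true  | false
∈-from-χ*χ p x y ()   | false | _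

χ*χ≤1 : ∀ {n} (p : Subset n) x y → χ p x * χ p y * 1 ≤ 1
χ*χ≤1 p x y = *-mono-≤ (*-mono-≤ (indicator≤1 (lookup p x)) (indicator≤1 (lookup p y))) (≤-refl {1})

module _ {v c : ℕ} (f : Fin v → Fin c) where

  colourMass : (Fin v → ℕ) → Fin c → ℕ
  colourMass u γ = ∑[ x < v ] (u x * indicator ⌊ f x ≟ γ ⌋)

  bichromaticPairs : (Fin v → ℕ) → ℕ
  bichromaticPairs u = ∑[ x < v ] ∑[ y < v ] (u x * u y * indicator (not ⌊ f x ≟ f y ⌋))

  ∣p∩colourClass∣≡colourMass : ∀ p γ → ∣ p ∩ colourClass f γ ∣ ≡ colourMass (χ p) γ
  ∣p∩colourClass∣≡colourMass p γ = trans (∣p∣≡∑χ (p ∩ colourClass f γ)) (sum-cong-≗ λ x →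
    trans (χ-∩ p (colourClass f γ) x) (cong (λ b → χ p x * indicator b) (lookup∘tabulate (λ y → ⌊ f y ≟ γ ⌋) x)))

  ∑colourMass≡sum : ∀ u → ∑[ γ < c ] colourMass u γ ≡ sum u
  ∑colourMass≡sum u = trans (∑-comm (λ γ x → u x * indicator ⌊ f x ≟ γ ⌋)) (sum-cong-≗ λ x →
    trans (sum-cong-≗ (λ γ → *-comm (u x) (indicator ⌊ f x ≟ γ ⌋))) (sum-δ (f x) (λ _ → u x)))

  monochromaticPairs≡∑colourMass² : ∀ u →
    ∑[ x < v ] ∑[ y < v ] (u x * u y * indicator ⌊ f x ≟ f y ⌋) ≡ ∑[ γ < c ] (colourMass u γ * colourMass u γ)
  monochromaticPairs≡∑colourMass² u = begin
    ∑[ x < v ] ∑[ y < v ] (u x * u y * indicator ⌊ f x ≟ f y ⌋)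
      ≡⟨ sum-cong-≗ (λ x → sum-cong-≗ λ y → cong (u x * u y *_) (sym (sum-δ (f y) (e x)))) ⟩
    ∑[ x < v ] ∑[ y < v ] (u x * u y * ∑[ γ < c ] (e y γ * e x γ))
      ≡⟨ sum-cong-≗ (λ x → sum-cong-≗ λ y → *-distribˡ-sum (u x * u y) (λ γ → e y γ * e x γ)) ⟩
    ∑[ x < v ] ∑[ y < v ] ∑[ γ < c ] (u x * u y * (e y γ * e x γ))
      ≡⟨ sum-cong-≗ (λ x → sum-cong-≗ λ y → sum-cong-≗ λ γ → regroup (u x) (u y) (e x γ) (e y γ)) ⟩
    ∑[ x < v ] ∑[ y < v ] ∑[ γ < c ] (u x * e x γ * (u y * e y γ))
      ≡⟨ sum-cong-≗ (λ x → ∑-comm (λ y γ → u x * e x γ * (u y * e y γ))) ⟩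
    ∑[ x < v ] ∑[ γ < c ] ∑[ y < v ] (u x * e x γ * (u y * e y γ))
      ≡⟨ ∑-comm (λ x γ → ∑[ y < v ] (u x * e x γ * (u y * e y γ))) ⟩
    ∑[ γ < c ] ∑[ x < v ] ∑[ y < v ] (u x * e x γ * (u y * e y γ))
      ≡⟨ sum-cong-≗ (λ γ → sym (sum*sum (λ x → u x * e x γ) (λ y → u y * e y γ))) ⟩
    ∑[ γ < c ] (colourMass u γ * colourMass u γ) ∎
    where
    open ≡-Reasoning
    e : Fin v → Fin c → ℕ
    e x γ = indicator ⌊ f x ≟ γ ⌋
    regroup : ∀ a b s t → a * b * (t * s) ≡ a * s * (b * t)
    regroup = solve-∀

  sum²≡∑colourMass²+bichromaticPairs : ∀ u →
    sum u * sum u ≡ ∑[ γ < c ] (colourMass u γ * colourMass u γ) + bichromaticPairs u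
  sum²≡∑colourMass²+bichromaticPairs u = begin
    sum u * sum u
      ≡⟨ sum*sum u u ⟩
    ∑[ x < v ] ∑[ y < v ] (u x * u y)
      ≡⟨ sum-cong-≗ (λ x → sum-cong-≗ λ y → split-by-indicator (u x * u y) ⌊ f x ≟ f y ⌋) ⟩
    ∑[ x < v ] ∑[ y < v ] (mono x y + bi x y)
      ≡⟨ sum-cong-≗ (λ x → ∑-distrib-+ (mono x) (bi x)) ⟩
    ∑[ x < v ] (∑[ y < v ] mono x y + ∑[ y < v ] bi x y)
      ≡⟨ ∑-distrib-+ (λ x → ∑[ y < v ] mono x y) (λ x → ∑[ y < v ] bi x y) ⟩
    ∑[ x < v ] ∑[ y < v ] mono x y + bichromaticPairs u
      ≡⟨ cong (_+ bichromaticPairs u) (monochromaticPairs≡∑colourMass² u) ⟩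
    ∑[ γ < c ] (colourMass u γ * colourMass u γ) + bichromaticPairs u ∎
    where
    open ≡-Reasoning
    mono bi : Fin v → Fin v → ℕ
    mono x y = u x * u y * indicator ⌊ f x ≟ f y ⌋
    bi   x y = u x * u y * indicator (not ⌊ f x ≟ f y ⌋)

  ∑bichromaticPairs≤ : ∀ {k m} (B : Fin m → Subset v) → IsPacking v k m B →
    ∑[ i < m ] bichromaticPairs (χ (B i)) ≤ bichromaticPairs (λ _ → 1)
  ∑bichromaticPairs≤ {m = m} B (_ , unique) = begin
    ∑[ i < m ] ∑[ x < v ] ∑[ y < v ] term i x y
      ≡⟨ ∑-comm (λ i x → ∑[ y < v ] term i x y) ⟩
    ∑[ x < v ] ∑[ i < m ] ∑[ y < v ] term i x y
      ≡⟨ sum-cong-≗ (λ x → ∑-comm (λ i y → term i x y)) ⟩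
    ∑[ x < v ] ∑[ y < v ] ∑[ i < m ] term i x y
      ≤⟨ sum-mono-≤ (λ x → sum-mono-≤ (λ y → pair-in-at-most-one-block x y)) ⟩
    bichromaticPairs (λ _ → 1) ∎
    where
    open ≤-Reasoning
    term : Fin m → Fin v → Fin v → ℕ
    term i x y = χ (B i) x * χ (B i) y * indicator (not ⌊ f x ≟ f y ⌋)
    pair-in-at-most-one-block : ∀ x y → ∑[ i < m ] term i x y ≤ 1 * 1 * indicator (not ⌊ f x ≟ f y ⌋)
    pair-in-at-most-one-block x y with f x ≟ f y
    ... | yes _     = ≤-reflexive (sum-zero (λ i → *-zeroʳ (χ (B i) x * χ (B i) y)))
    ... | no fx≢fy  = sum-≤1 _ (λ i → χ*χ≤1 (B i) x y) λ i j inᵢ inⱼ →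
      let x∈Bᵢ , y∈Bᵢ = ∈-from-χ*χ (B i) x y inᵢ
          x∈Bⱼ , y∈Bⱼ = ∈-from-χ*χ (B j) x y inⱼ
      in unique x y (fx≢fy ∘ cong f) i j x∈Bᵢ y∈Bᵢ x∈Bⱼ y∈Bⱼ

near-square : ∀ {q n} → q ≤ n → n ≤ suc q → n * n + q * suc q ≡ (2 * q + 1) * n
near-square {q} q≤n n≤1+q with m≤n⇒m<n∨m≡n n≤1+q
... | inj₂ refl = at-suc q
  where
  at-suc : ∀ q → suc q * suc q + q * suc q ≡ (2 * q + 1) * suc q
  at-suc = solve-∀
... | inj₁ (s≤s n≤q) rewrite ≤-antisym n≤q q≤n = at-self q
  where
  at-self : ∀ q → q * q + q * suc q ≡ (2 * q + 1) * q
  at-self = solve-∀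

-- The gap is (a − ρ)(a − ρ − 1), which is d (d + 1) in both cases.
square-lower-bound : ∀ ρ a → (2 * ρ + 1) * a ≤ a * a + ρ * suc ρ
square-lower-bound ρ a with a ≤? ρ
... | yes a≤ρ with d , refl ← m≤n⇒∃[o]m+o≡n a≤ρ = ≤-trans (m≤m+n _ (d * suc d)) (≤-reflexive (gap a d))
  where
  gap : ∀ a d → (2 * (a + d) + 1) * a + d * suc d ≡ a * a + (a + d) * suc (a + d)
  gap = solve-∀
... | no a≰ρ with d , refl ← m≤n⇒∃[o]m+o≡n (≰⇒> a≰ρ) = ≤-trans (m≤m+n _ (d * suc d)) (≤-reflexive (gap ρ d))
  where
  gap : ∀ ρ d → (2 * ρ + 1) * suc (ρ + d) + d * suc d ≡ suc (ρ + d) * suc (ρ + d) + ρ * suc ρ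
  gap = solve-∀

-- For b < c, split q c + b into b parts of size q + 1 and c − b parts of size q: these are the sum
-- of the squares of the parts and the number of ordered pairs lying in different parts. The latter
-- is twice the paper's numerator (q = ρ, b = β) and denominator.
balancedSquares : ℕ → ℕ → ℕ → ℕ
balancedSquares c q b = c * q * q + 2 * b * q + b

balancedCrossPairs : ℕ → ℕ → ℕ → ℕ
balancedCrossPairs c q b = q * (q * c + 2 * b) * (c ∸ 1) + b * (b ∸ 1)

balancedSquares+c*q*[1+q] : ∀ c q b → balancedSquares c q b + c * (q * suc q) ≡ (2 * q + 1) * (q * c + b)
balancedSquares+c*q*[1+q] = expanded
  where
  expanded : ∀ c q b → c * q * q + 2 * b * q + b + c * (q * suc q) ≡ (2 * q + 1) * (q * c + b)
  expanded = solve-∀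

square≡balancedCrossPairs+balancedSquares : ∀ c q b →
  (q * suc c + b) * (q * suc c + b) ≡ balancedCrossPairs (suc c) q b + balancedSquares (suc c) q b
square≡balancedCrossPairs+balancedSquares c q zero = without-remainder c q
  where
  without-remainder : ∀ c q → (q * suc c + 0) * (q * suc c + 0)
    ≡ q * (q * suc c + 2 * 0) * c + 0 * 0 + (suc c * q * q + 2 * 0 * q + 0)
  without-remainder = solve-∀
square≡balancedCrossPairs+balancedSquares c q (suc b) = with-remainder c q b
  where
  with-remainder : ∀ c q b → (q * suc c + suc b) * (q * suc c + suc b)
    ≡ q * (q * suc c + 2 * suc b) * c + suc b * b + (suc c * q * q + 2 * suc b * q + suc b)
  with-remainder = solve-∀

∑²≡balancedSquares : ∀ {c} q b (a : Fin c → ℕ) → (∀ γ → q ≤ a γ × a γ ≤ suc q) →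
  sum a ≡ q * c + b → ∑[ γ < c ] (a γ * a γ) ≡ balancedSquares c q b
∑²≡balancedSquares {c} q b a a≈q ∑a≡ = +-cancelʳ-≡ (c * (q * suc q)) _ _ (begin
  ∑[ γ < c ] (a γ * a γ) + c * (q * suc q)  ≡⟨ sum-plus-const (λ γ → a γ * a γ) (q * suc q) ⟨
  ∑[ γ < c ] (a γ * a γ + q * suc q)        ≡⟨ sum-cong-≗ (λ γ → near-square (proj₁ (a≈q γ)) (proj₂ (a≈q γ))) ⟩
  ∑[ γ < c ] ((2 * q + 1) * a γ)            ≡⟨ *-distribˡ-sum (2 * q + 1) a ⟨
  (2 * q + 1) * sum a                       ≡⟨ cong ((2 * q + 1) *_) ∑a≡ ⟩
  (2 * q + 1) * (q * c + b)                 ≡⟨ balancedSquares+c*q*[1+q] c q b ⟨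
  balancedSquares c q b + c * (q * suc q)   ∎)
  where open ≡-Reasoning

balancedSquares≤∑² : ∀ {c} ρ β (a : Fin c → ℕ) → sum a ≡ ρ * c + β →
  balancedSquares c ρ β ≤ ∑[ γ < c ] (a γ * a γ)
balancedSquares≤∑² {c} ρ β a ∑a≡ = +-cancelʳ-≤ (c * (ρ * suc ρ)) _ _ (begin
  balancedSquares c ρ β + c * (ρ * suc ρ)  ≡⟨ balancedSquares+c*q*[1+q] c ρ β ⟩
  (2 * ρ + 1) * (ρ * c + β)                ≡⟨ cong ((2 * ρ + 1) *_) ∑a≡ ⟨
  (2 * ρ + 1) * sum a                      ≡⟨ *-distribˡ-sum (2 * ρ + 1) a ⟩
  ∑[ γ < c ] ((2 * ρ + 1) * a γ)           ≤⟨ sum-mono-≤ (λ γ → square-lower-bound ρ (a γ)) ⟩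
  ∑[ γ < c ] (a γ * a γ + ρ * suc ρ)       ≡⟨ sum-plus-const (λ γ → a γ * a γ) (ρ * suc ρ) ⟩
  ∑[ γ < c ] (a γ * a γ) + c * (ρ * suc ρ) ∎)
  where open ≤-Reasoning

q≤floorDiv : ∀ c q b → q ≤ floorDiv (q * suc c + b) (suc c)
q≤floorDiv c q b = subst (_≤ (q * suc c + b) / suc c) (m*n/n≡m q (suc c)) (/-monoˡ-≤ (suc c) (m≤m+n (q * suc c) b))

ceilDiv≤1+q : ∀ c q b → b < suc c → ceilDiv (q * suc c + b) (suc c) ≤ suc q
ceilDiv≤1+q c q b b<1+c = ≤-pred (m<n*o⇒m/o<n (subst (_< suc (suc q) * suc c) (sym drop-one) bound))
  where
  drop-one : q * suc c + b + suc c ∸ 1 ≡ q * suc c + b + c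
  drop-one = cong (_∸ 1) (+-suc (q * suc c + b) c)
  bound : q * suc c + b + c < suc (suc q) * suc c
  bound = <-≤-trans (+-mono-< (+-monoʳ-< (q * suc c) b<1+c) (n<1+n c)) (≤-reflexive (two-more c q))
    where
    two-more : ∀ c q → q * suc c + suc c + suc c ≡ suc (suc q) * suc c
    two-more = solve-∀

module _ {v c : ℕ} (f : Fin v → Fin (suc c)) where

  bichromaticPairs-equitableBlock : ∀ q b (p : Subset v) → b < suc c → ∣ p ∣ ≡ q * suc c + b →
    (∀ γ → floorDiv (q * suc c + b) (suc c) ≤ ∣ p ∩ colourClass f γ ∣ ×
           ∣ p ∩ colourClass f γ ∣ ≤ ceilDiv (q * suc c + b) (suc c)) →
    bichromaticPairs f (χ p) ≡ balancedCrossPairs (suc c) q b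
  bichromaticPairs-equitableBlock q b p b<1+c ∣p∣≡k equitable =
    +-cancelʳ-≡ (balancedSquares (suc c) q b) _ _ (begin
      bichromaticPairs f (χ p) + balancedSquares (suc c) q b
        ≡⟨ cong (bichromaticPairs f (χ p) +_) (∑²≡balancedSquares q b mass mass≈q ∑mass≡k) ⟨
      bichromaticPairs f (χ p) + ∑[ γ < suc c ] (mass γ * mass γ)
        ≡⟨ +-comm (bichromaticPairs f (χ p)) _ ⟩
      ∑[ γ < suc c ] (mass γ * mass γ) + bichromaticPairs f (χ p)
        ≡⟨ sum²≡∑colourMass²+bichromaticPairs f (χ p) ⟨
      sum (χ p) * sum (χ p)
        ≡⟨ cong (λ t → t * t) ∑χ≡k ⟩
      (q * suc c + b) * (q * suc c + b)
        ≡⟨ square≡balancedCrossPairs+balancedSquares c q b ⟩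
      balancedCrossPairs (suc c) q b + balancedSquares (suc c) q b ∎)
    where
    open ≡-Reasoning
    mass : Fin (suc c) → ℕ
    mass = colourMass f (χ p)
    ∑χ≡k : sum (χ p) ≡ q * suc c + b
    ∑χ≡k = trans (sym (∣p∣≡∑χ p)) ∣p∣≡k
    ∑mass≡k : sum mass ≡ q * suc c + b
    ∑mass≡k = trans (∑colourMass≡sum f (χ p)) ∑χ≡k
    mass≈q : ∀ γ → q ≤ mass γ × mass γ ≤ suc q
    mass≈q γ = subst (λ n → q ≤ n × n ≤ suc q) (∣p∩colourClass∣≡colourMass f p γ)
      ( ≤-trans (q≤floorDiv c q b) (proj₁ (equitable γ))
      , ≤-trans (proj₂ (equitable γ)) (ceilDiv≤1+q c q b b<1+c))

  bichromaticPairs-all≤ : ∀ ρ β → v ≡ ρ * suc c + β →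
    bichromaticPairs f (λ _ → 1) ≤ balancedCrossPairs (suc c) ρ β
  bichromaticPairs-all≤ ρ β v≡ = +-cancelʳ-≤ (balancedSquares (suc c) ρ β) _ _ (begin
      bichromaticPairs f all + balancedSquares (suc c) ρ β
        ≤⟨ +-monoʳ-≤ (bichromaticPairs f all) (balancedSquares≤∑² ρ β mass ∑mass≡v) ⟩
      bichromaticPairs f all + ∑[ γ < suc c ] (mass γ * mass γ)
        ≡⟨ +-comm (bichromaticPairs f all) _ ⟩
      ∑[ γ < suc c ] (mass γ * mass γ) + bichromaticPairs f all
        ≡⟨ sum²≡∑colourMass²+bichromaticPairs f all ⟨
      sum all * sum all
        ≡⟨ cong (λ t → t * t) ∑all≡v ⟩
      (ρ * suc c + β) * (ρ * suc c + β)
        ≡⟨ square≡balancedCrossPairs+balancedSquares c ρ β ⟩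
      balancedCrossPairs (suc c) ρ β + balancedSquares (suc c) ρ β ∎)
    where
    open ≤-Reasoning
    all : Fin v → ℕ
    all _ = 1
    mass : Fin (suc c) → ℕ
    mass = colourMass f all
    ∑all≡v : sum all ≡ ρ * suc c + β
    ∑all≡v = trans (sum-const v 1) (trans (*-identityʳ v) v≡)
    ∑mass≡v : sum mass ≡ ρ * suc c + β
    ∑mass≡v = trans (∑colourMass≡sum f all) ∑all≡v

theorem2p8 : (v k c q b ρ β m : ℕ) → 3 ≤ k → k ≤ v → 2 ≤ c →
    k ≡ q * c + b → b < c → v ≡ ρ * c + β → β < c →
    Σ (Fin m → Subset v) (λ B → Σ (Fin v → Fin c) (λ f →
      IsPacking v k m B × IsBlockEquitable v k m c B f)) →
    m * (q * (q * c + 2 * b) * (c ∸ 1) + b * (b ∸ 1))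
      ≤ ρ * (ρ * c + 2 * β) * (c ∸ 1) + β * (β ∸ 1)
theorem2p8 v k zero q b ρ β m _ _ () _ _ _ _ _
theorem2p8 v .(q * suc c + b) (suc c) q b ρ β m _ _ _ refl b<c v≡ _ (B , f , packing , equitable) = begin
  m * balancedCrossPairs (suc c) q b            ≡⟨ sum-const m _ ⟨
  ∑[ i < m ] balancedCrossPairs (suc c) q b     ≡⟨ sum-cong-≗ block ⟨
  ∑[ i < m ] bichromaticPairs f (χ (B i))       ≤⟨ ∑bichromaticPairs≤ f B packing ⟩
  bichromaticPairs f (λ _ → 1)                  ≤⟨ bichromaticPairs-all≤ f ρ β v≡ ⟩
  balancedCrossPairs (suc c) ρ β                ∎
  where
  open ≤-Reasoning
  block : ∀ i → bichromaticPairs f (χ (B i)) ≡ balancedCrossPairs (suc c) q b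
  block i = bichromaticPairs-equitableBlock f q b (B i) b<c (proj₁ packing i) (equitable i)
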